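{- Let $(W,S)$ be a Coxeter system with $S=\{s_0,\ldots,s_n\}$ in which $s_0$ is an even leaf, with $W^+$, $R$, $\ell_{R\cup R^{ -1}}$, $\mathrm{Des}_{R\cup R^{ -1}}$ and the Coxeter system $(W',S')$ as in the context. Introduce commuting indeterminates $q$ and $x_a$ for $a\in R\cup R^{ -1}$, and $y_b$ for $b\in S'$. Then $$\sum_{w\in W^+}\Big(\prod_{a\in\mathrm{Des}_{R\cup R^{ -1}}(w)}x_a\Big)q^{\ell_{R\cup R^{ -1}}(w)}=\sum_{u\in W'}\Phi_{\ell_{S'}(u)}\Big(\prod_{b\in \mathrm{Des}_{S'}(u)}y_b\Big)q^{\ell_{S'}(u)},$$ where $\Phi_\ell$ is the substitution $y_{t_j}\mapsto x_{r_j}$ for $j\ge2$, and $y_{t_1'}\mapsto x_{r_1}$, $y_{t_1}\mapsto x_{r_1^{ -1}}$ if $\ell$ is even, respectively $y_{t_1}\mapsto x_{r_1}$, $y_{t_1'}\mapsto x_{r_1^{ -1}}$ if $\ell$ is odd. In particular, with $\mathrm{des}=|\mathrm{Des}|$, $$\sum_{w\in W^+}t^{\mathrm{des}_{R\cup R^{ -1}}(w)}q^{\ell_{R\cup R^{ -1}}(w)}=\sum_{u\in W'}t^{\mathrm{des}_{S'}(u)}q^{\ell_{S'}(u)}\quad\text{and}\quad \sum_{w\in W^+}q^{\ell_{R\cup R^{ -1}}(w)}=\sum_{u\in W'}q^{\ell_{S'}(u)}.$$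
   Context: Coxeter system $(W,S)$, $S=\{s_0,\ldots,s_n\}$, with relations $s_i^2=e$, $(s_is_j)^{m_{ij}}=e$. $s_0$ is an even leaf: $m_{01}$ even (or $\infty$) and $m_{0j}=2$ for $j\ge2$. $W^+=\ker\epsilon$ where $\epsilon(s)=-1$ for $s\in S$, generated by $R=\{r_1,\ldots,r_n\}$, $r_i=s_0s_i$. $\ell_{R\cup R^{ -1}}(w)$ is the minimal length of a word in $R\cup R^{ -1}$ factoring $w$; $\mathrm{Des}_{R\cup R^{ -1}}(w)=\{r\in R\cup R^{ -1}:\ell_{R\cup R^{ -1}}(wr)<\ell_{R\cup R^{ -1}}(w)\}$. $W'=\ker\chi_0$, where $\chi_0(s_0)=-1$, $\chi_0(s_j)=1$ for $j\ge1$; $S'=\{t_1,\ldots,t_n,t_1'\}$ with $t_j=s_j$, $t_1'=s_0s_1s_0$, and $(W',S')$ is a Coxeter system with length $\ell_{S'}$ and descent set $\mathrm{Des}_{S'}(u)=\{t\in S':\ell_{S'}(ut)<\ell_{S'}(u)\}$. Generating functions are formal power series in $q$ (with polynomial coefficients). -}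

module Defs where

open import Data.Nat using (ℕ; zero; suc; _≤_; _<_)
open import Data.Nat.Divisibility using (_∣_)
open import Data.Fin using (Fin; zero; suc)
open import Data.Bool using (Bool; true; false; if_then_else_)
open import Data.Maybe using (Maybe; just; nothing)
open import Data.List using (List; []; _∷_; _++_; length; concatMap)
open import Data.List.Relation.Unary.All using (All)
open import Data.List.Relation.Unary.Any using (Any)
open import Data.List.Relation.Unary.AllPairs using (AllPairs)
open import Data.Product using (Σ; _×_)
open import Data.Sum using (_⊎_; inj₁; inj₂)
open import Data.Unit using (⊤; tt)
open import Relation.Binary.PropositionalEquality using (_≡_; _≢_)
open import Relation.Nullary using (¬_)

-- Generators s_0, …, s_n with n = suc m ≥ 1 (so that s_1 exists).
-- s_0 = zero, s_1 = suc zero, s_j (j ≥ 2) = suc (suc _).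
Gen : ℕ → Set
Gen m = Fin (suc (suc m))

-- Coxeter matrix entries: just k = finite m_ij = k, nothing = ∞.
record IsCoxeterMatrix {m : ℕ} (M : Gen m → Gen m → Maybe ℕ) : Set where
  field
    diag    : ∀ i → M i i ≡ just 1
    symm    : ∀ i j → M i j ≡ M j i
    offdiag : ∀ i j → i ≢ j → M i j ≡ nothing ⊎ Σ ℕ (λ k → 2 ≤ k × M i j ≡ just k)

record EvenLeaf {m : ℕ} (M : Gen m → Gen m → Maybe ℕ) : Set where
  field
    m01  : M zero (suc zero) ≡ nothing ⊎ Σ ℕ (λ k → 2 ∣ k × M zero (suc zero) ≡ just k)
    m0j  : ∀ (j : Fin m) → M zero (suc (suc j)) ≡ just 2

rep : {A : Set} → ℕ → List A → List A
rep zero    w = []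
rep (suc k) w = w ++ rep k w

isEven : ℕ → Bool
isEven zero    = true
isEven (suc k) with isEven k
... | true  = false
... | false = true

-- The Coxeter group W given by its presentation: words in S modulo the
-- congruence generated by s_i^2 = e and (s_i s_j)^{m_ij} = e (m_ij finite).
module Cox {m : ℕ} (M : Gen m → Gen m → Maybe ℕ) where

  Word : Set
  Word = List (Gen m)

  data Basic : Word → Word → Set where
    inv   : ∀ i → Basic (i ∷ i ∷ []) []
    braid : ∀ i j k → M i j ≡ just k → Basic (rep k (i ∷ j ∷ [])) []

  infix 4 _≈_
  data _≈_ : Word → Word → Set where
    ≈-refl  : ∀ {u} → u ≈ u
    ≈-sym   : ∀ {u v} → u ≈ v → v ≈ u
    ≈-trans : ∀ {u v w} → u ≈ v → v ≈ w → u ≈ w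
    ≈-step  : ∀ u v {a b} → Basic a b → (u ++ a ++ v) ≈ (u ++ b ++ v)

  s₀ s₁ : Gen m
  s₀ = zero
  s₁ = suc zero

  -- W⁺ = ker ε, ε(s) = -1 : words of even length.
  InW⁺ : Word → Set
  InW⁺ w = 2 ∣ length w

  count₀ : Word → ℕ
  count₀ []            = 0
  count₀ (zero  ∷ w)   = suc (count₀ w)
  count₀ (suc _ ∷ w)   = count₀ w

  -- W' = ker χ₀, χ₀(s₀) = -1, χ₀(s_j) = 1 (j ≥ 1).
  InW' : Word → Set
  InW' w = 2 ∣ count₀ w

  -- Alphabet for R ∪ R⁻¹:  inj₁ i ↦ r_{i+1} = s₀ s_{i+1},  inj₂ i ↦ r_{i+1}⁻¹ = s_{i+1} s₀.
  RLetter : Set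
  RLetter = Fin (suc m) ⊎ Fin (suc m)

  eR : RLetter → Word
  eR (inj₁ i) = s₀ ∷ suc i ∷ []
  eR (inj₂ i) = suc i ∷ s₀ ∷ []

  -- Alphabet for S' = {t_1,…,t_n, t_1'}:  inj₁ i ↦ t_{i+1} = s_{i+1},  inj₂ tt ↦ t_1' = s₀ s₁ s₀.
  S'Letter : Set
  S'Letter = Fin (suc m) ⊎ ⊤

  eS' : S'Letter → Word
  eS' (inj₁ i)  = suc i ∷ []
  eS' (inj₂ tt) = s₀ ∷ s₁ ∷ s₀ ∷ []

  IsLen : {A : Set} → (A → Word) → Word → ℕ → Set
  IsLen {A} e w k =
    Σ (List A) (λ as → length as ≡ k × concatMap e as ≈ w)
    × (∀ (as : List A) → concatMap e as ≈ w → k ≤ length as)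

  InGens : {A : Set} → (A → Word) → Word → Set
  InGens {A} e a = Σ A (λ x → e x ≈ a)

  InDes : {A : Set} → (A → Word) → Word → Word → Set
  InDes e w a = InGens e a × Σ ℕ (λ k → Σ ℕ (λ k' → IsLen e w k × IsLen e (w ++ a) k' × k' < k))

  ℓR-is : Word → ℕ → Set
  ℓR-is = IsLen eR

  ℓS'-is : Word → ℕ → Set
  ℓS'-is = IsLen eS'

  DesR : Word → Word → Set
  DesR = InDes eR

  DesS' : Word → Word → Set
  DesS' = InDes eS'

  -- The substitution Φ_ℓ on variables, as a map S' → R ∪ R⁻¹ on group elements:
  -- ℓ even: t ↦ t s₀  (t_j ↦ r_j, t_1 ↦ r_1⁻¹, t_1' ↦ r_1);
  -- ℓ odd : t ↦ s₀ t  (t_j ↦ r_j, t_1 ↦ r_1,  t_1' ↦ r_1⁻¹).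
  φ : ℕ → Word → Word
  φ ℓ t = if isEven ℓ then t ++ (s₀ ∷ []) else s₀ ∷ t

  HasCard : (Word → Set) → ℕ → Set
  HasCard P c = Σ (List Word) (λ xs →
      length xs ≡ c
    × All P xs
    × AllPairs (λ a b → ¬ (a ≈ b)) xs
    × (∀ w → P w → Any (λ x → w ≈ x) xs))

{-# OPTIONS --safe #-}

-- Because m₀₁ is even, χ₀ is well defined, so ε and χ₀ are homomorphisms W → ℤ/2 that both
-- send s₀ to 1.  Appending s₀ where needed therefore gives mutually inverse bijections
-- ψ : W' → W⁺, u ↦ u s₀^{ε(u)}, and γ : W⁺ → W', w ↦ w s₀^{χ₀(w)}.  For t ∈ S' both t s₀ and
-- s₀ t lie in R ∪ R⁻¹, and, as s₀ commutes with s_j for j ≥ 2, for a ∈ R ∪ R⁻¹ both a s₀ and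
-- s₀ a lie in S'.  Hence an S'-word t₁ t₂ t₃ ⋯ t_k for u becomes the (R ∪ R⁻¹)-word
-- (t₁ s₀)(s₀ t₂)(t₃ s₀) ⋯ of the same length for ψ(u), and conversely, so
-- ℓ_{R∪R⁻¹}(ψ u) = ℓ_{S'}(u).  Finally ψ(u t) = ψ(u) Φ_ℓ(t) for t ∈ S' and ℓ = ℓ_{S'}(u), so
-- Φ_ℓ carries Des_{S'}(u) bijectively onto Des_{R∪R⁻¹}(ψ u).
module Submission where

open import Defs
open import Data.Nat as ℕ using (ℕ; zero; suc; _≤_; parity)
open import Data.Nat.Properties using (+-cancelˡ-≡; +-identityʳ)
open import Data.Nat.Divisibility using (_∣_; divides)
open import Data.Parity.Base as ℙ using (Parity; 0ℙ; 1ℙ; _⁻¹; _+_)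
open import Data.Parity.Properties
  using (+-homo-+; *-homo-*; *-zeroˡ; *-zeroʳ; p+p≡0ℙ; suc-homo-⁻¹)
open import Data.Fin using (zero; suc)
open import Data.Bool using (true; false; if_then_else_)
open import Data.Maybe using (Maybe; just)
open import Data.Maybe.Properties using (just-injective)
open import Data.List using (List; []; _∷_; _++_; length; map; concatMap)
open import Data.List.Properties using (++-assoc; ++-identityʳ; length-++; length-map)
open import Data.List.Relation.Unary.All as All using (All; []; _∷_)
import Data.List.Relation.Unary.All.Properties as Allₚ
open import Data.List.Relation.Unary.Any using (Any)
import Data.List.Relation.Unary.Any.Properties as Anyₚ
open import Data.List.Relation.Unary.AllPairs using (AllPairs; []; _∷_)
open import Data.Product using (Σ; _×_; _,_)
open import Data.Sum using (_⊎_; inj₁; inj₂)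
open import Data.Unit using (tt)
open import Function using (_∘_; id)
open import Function.Bundles using (_⇔_; mk⇔)
open import Function.Construct.Composition using (_⇔-∘_)
open import Function.Construct.Symmetry using (⇔-sym)
open import Level using (0ℓ)
open import Relation.Binary.Bundles using (Setoid)
open import Relation.Binary.PropositionalEquality
  using (_≡_; refl; sym; trans; cong; cong₂; subst; module ≡-Reasoning)
import Relation.Binary.Reasoning.Setoid as SetoidReasoning
open import Relation.Nullary using (¬_)

2∣⇒parity≡0ℙ : ∀ {n} → 2 ∣ n → parity n ≡ 0ℙ
2∣⇒parity≡0ℙ (divides q refl) = trans (*-homo-* q 2) (*-zeroʳ (parity q))

parity≡0ℙ⇒2∣ : ∀ n → parity n ≡ 0ℙ → 2 ∣ n
parity≡0ℙ⇒2∣ zero          _ = divides 0 refl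
parity≡0ℙ⇒2∣ (suc (suc n)) e with parity≡0ℙ⇒2∣ n e
... | divides q refl = divides (suc q) refl

p≡0ℙ⊎q≡0ℙ⇒p*q≡0ℙ : ∀ {p q} → p ≡ 0ℙ ⊎ q ≡ 0ℙ → p ℙ.* q ≡ 0ℙ
p≡0ℙ⊎q≡0ℙ⇒p*q≡0ℙ {q = q} (inj₁ refl) = *-zeroˡ q
p≡0ℙ⊎q≡0ℙ⇒p*q≡0ℙ {p}     (inj₂ refl) = *-zeroʳ p

p⁻¹+parity≡p+parity-suc : ∀ p n → p ⁻¹ + parity n ≡ p + parity (suc n)
p⁻¹+parity≡p+parity-suc 0ℙ n = sym (+-homo-+ 1 n)
p⁻¹+parity≡p+parity-suc 1ℙ n = sym (suc-homo-⁻¹ n)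

isEven-suc-suc : ∀ n → isEven (suc (suc n)) ≡ isEven n
isEven-suc-suc n with isEven n
... | true  = refl
... | false = refl

module _ {A : Set} (f : List A → ℕ) (f-++ : ∀ xs ys → f (xs ++ ys) ≡ f xs ℕ.+ f ys) where

  additive-[] : f [] ≡ 0
  additive-[] =
    +-cancelˡ-≡ (f []) (f []) 0 (trans (sym (f-++ [] [])) (sym (+-identityʳ (f []))))

  additive-rep : ∀ k xs → f (rep k xs) ≡ k ℕ.* f xs
  additive-rep zero    xs = additive-[]
  additive-rep (suc k) xs = trans (f-++ xs (rep k xs)) (cong (f xs ℕ.+_) (additive-rep k xs))

alternate : {A B : Set} → (Parity → A → B) → Parity → List A → List B
alternate f p []       = []
alternate f p (a ∷ as) = f p a ∷ alternate f (p ⁻¹) as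

length-alternate : {A B : Set} (f : Parity → A → B) →
                   ∀ p as → length (alternate f p as) ≡ length as
length-alternate f p []       = refl
length-alternate f p (a ∷ as) = cong suc (length-alternate f (p ⁻¹) as)

module _ {m : ℕ} {M : Gen m → Gen m → Maybe ℕ} where
  open Cox M

  ≈-setoid : Setoid 0ℓ 0ℓ
  ≈-setoid = record
    { Carrier       = Word
    ; _≈_           = _≈_
    ; isEquivalence = record { refl = ≈-refl ; sym = ≈-sym ; trans = ≈-trans }
    }

  module ≈-Reasoning = SetoidReasoning ≈-setoid

  ≡⇒≈ : ∀ {u v} → u ≡ v → u ≈ v
  ≡⇒≈ refl = ≈-refl

  ++-congˡ : ∀ x {u v} → u ≈ v → (x ++ u) ≈ (x ++ v)
  ++-congˡ x ≈-refl        = ≈-refl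
  ++-congˡ x (≈-sym p)     = ≈-sym (++-congˡ x p)
  ++-congˡ x (≈-trans p q) = ≈-trans (++-congˡ x p) (++-congˡ x q)
  ++-congˡ x (≈-step u v {a} {b} s) = begin
    x ++ u ++ a ++ v    ≡⟨ ++-assoc x u _ ⟨
    (x ++ u) ++ a ++ v  ≈⟨ ≈-step (x ++ u) v s ⟩
    (x ++ u) ++ b ++ v  ≡⟨ ++-assoc x u _ ⟩
    x ++ u ++ b ++ v    ∎
    where open ≈-Reasoning

  ++-congʳ : ∀ x {u v} → u ≈ v → (u ++ x) ≈ (v ++ x)
  ++-congʳ x ≈-refl        = ≈-refl
  ++-congʳ x (≈-sym p)     = ≈-sym (++-congʳ x p)
  ++-congʳ x (≈-trans p q) = ≈-trans (++-congʳ x p) (++-congʳ x q)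
  ++-congʳ x (≈-step u v {a} {b} s) = begin
    (u ++ a ++ v) ++ x  ≡⟨ trans (++-assoc u _ x) (cong (u ++_) (++-assoc a v x)) ⟩
    u ++ a ++ v ++ x    ≈⟨ ≈-step u (v ++ x) s ⟩
    u ++ b ++ v ++ x    ≡⟨ trans (++-assoc u _ x) (cong (u ++_) (++-assoc b v x)) ⟨
    (u ++ b ++ v) ++ x  ∎
    where open ≈-Reasoning

  ++-cong : ∀ {u u' v v'} → u ≈ u' → v ≈ v' → (u ++ v) ≈ (u' ++ v')
  ++-cong {u' = u'} {v = v} u≈u' v≈v' = ≈-trans (++-congʳ v u≈u') (++-congˡ u' v≈v')

  IsLen-transfer : {A B : Set} {eA : A → Word} {eB : B → Word} {v w : Word} {k : ℕ}
                   (f : List A → List B) (g : List B → List A) →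
                   (∀ as → length (f as) ≡ length as) → (∀ bs → length (g bs) ≡ length bs) →
                   (∀ as → concatMap eA as ≈ v → concatMap eB (f as) ≈ w) →
                   (∀ bs → concatMap eB bs ≈ w → concatMap eA (g bs) ≈ v) →
                   IsLen eA v k → IsLen eB w k
  IsLen-transfer f g |f| |g| f-word g-word ((as , |as|≡k , as≈v) , minimal) =
    (f as , trans (|f| as) |as|≡k , f-word as as≈v) ,
    λ bs bs≈w → subst (_ ≤_) (|g| bs) (minimal (g bs) (g-word bs bs≈w))

  IsLen-resp : {A : Set} {e : A → Word} {w w' : Word} {k : ℕ} →
               w ≈ w' → IsLen e w k → IsLen e w' k
  IsLen-resp w≈w' = IsLen-transfer id id (λ _ → refl) (λ _ → refl)
                      (λ _ p → ≈-trans p w≈w') (λ _ p → ≈-trans p (≈-sym w≈w'))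

  InDes-transfer : {A B : Set} {eA : A → Word} {eB : B → Word} {v w a b : Word} →
                   (InGens eA a → InGens eB b) →
                   (∀ {k} → IsLen eA v k → IsLen eB w k) →
                   (InGens eA a → ∀ {k} → IsLen eA (v ++ a) k → IsLen eB (w ++ b) k) →
                   InDes eA v a → InDes eB w b
  InDes-transfer gens len len-++ (a∈A , k , k' , L , L' , k'<k) =
    gens a∈A , k , k' , len L , len-++ a∈A L' , k'<k

  InDes-respʳ : {A : Set} {e : A → Word} {w a b : Word} → a ≈ b → InDes e w a → InDes e w b
  InDes-respʳ {w = w} a≈b =
    InDes-transfer (λ (x , ex≈a) → x , ≈-trans ex≈a a≈b) id (λ _ → IsLen-resp (++-congˡ w a≈b))

  infix 4 _≅_

  record _≅_ (P Q : Word → Set) : Set where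
    field
      to from   : Word → Word
      to-cong   : ∀ {u v} → u ≈ v → to u ≈ to v
      from-cong : ∀ {u v} → u ≈ v → from u ≈ from v
      to-pres   : ∀ {u} → P u → Q (to u)
      from-pres : ∀ {v} → Q v → P (from v)
      from∘to   : ∀ {u} → P u → from (to u) ≈ u
      to∘from   : ∀ {v} → Q v → to (from v) ≈ v

  ≅-sym : ∀ {P Q} → P ≅ Q → Q ≅ P
  ≅-sym e = record
    { to = from ; from = to ; to-cong = from-cong ; from-cong = to-cong
    ; to-pres = from-pres ; from-pres = to-pres ; from∘to = to∘from ; to∘from = from∘to }
    where open _≅_ e

  ≅-image : ∀ {P Q} (e : P ≅ Q) → (∀ {a b} → a ≈ b → Q a → Q b) →
            ∀ {a} → Q a ⇔ Σ Word (λ t → P t × _≅_.to e t ≈ a)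
  ≅-image e Q-resp {a} =
    mk⇔ (λ Qa → from a , from-pres Qa , to∘from Qa) (λ (t , Pt , t↦a) → Q-resp t↦a (to-pres Pt))
    where open _≅_ e

  HasCard-≅ : ∀ {P Q} → P ≅ Q → ∀ {c} → HasCard P c → HasCard Q c
  HasCard-≅ {P} {Q} e (xs , |xs|≡c , P-xs , xs-distinct , xs-complete) =
    map to xs , trans (length-map to xs) |xs|≡c , Allₚ.gmap⁺ to-pres P-xs ,
    map-distinct P-xs xs-distinct , complete
    where
    open _≅_ e

    to-injective : ∀ {x y} → P x → P y → ¬ x ≈ y → ¬ to x ≈ to y
    to-injective Px Py x≉y tx≈ty =
      x≉y (≈-trans (≈-sym (from∘to Px)) (≈-trans (from-cong tx≈ty) (from∘to Py)))

    map-distinct : ∀ {ys} → All P ys → AllPairs (λ a b → ¬ a ≈ b) ys →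
                   AllPairs (λ a b → ¬ a ≈ b) (map to ys)
    map-distinct []           []                 = []
    map-distinct (Py ∷ P-ys) (y≉ys ∷ distinct) =
      Allₚ.map⁺ (All.zipWith (λ (Pz , y≉z) → to-injective Py Pz y≉z) (P-ys , y≉ys)) ∷
      map-distinct P-ys distinct

    complete : ∀ v → Q v → Any (λ x → v ≈ x) (map to xs)
    complete v Qv = Anyₚ.gmap (λ fv≈x → ≈-trans (≈-sym (to∘from Qv)) (to-cong fv≈x))
                              (xs-complete (from v) (from-pres Qv))

  HasCard-cong : ∀ {P Q} → P ≅ Q → ∀ {c} → HasCard P c ⇔ HasCard Q c
  HasCard-cong e = mk⇔ (HasCard-≅ e) (HasCard-≅ (≅-sym e))

  ≈-invariant : {A : Set} (_∙_ : A → A → A) (h : Word → A) →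
                (∀ x y → h (x ++ y) ≡ h x ∙ h y) → (∀ {a b} → Basic a b → h a ≡ h b) →
                ∀ {u v} → u ≈ v → h u ≡ h v
  ≈-invariant _∙_ h h-++ h-basic = go
    where
    go : ∀ {u v} → u ≈ v → h u ≡ h v
    go ≈-refl        = refl
    go (≈-sym p)     = sym (go p)
    go (≈-trans p q) = trans (go p) (go q)
    go (≈-step u v {a} {b} s) = begin
      h (u ++ a ++ v)    ≡⟨ h-++ u (a ++ v) ⟩
      h u ∙ h (a ++ v)   ≡⟨ cong (h u ∙_) (h-++ a v) ⟩
      h u ∙ (h a ∙ h v)  ≡⟨ cong (λ z → h u ∙ (z ∙ h v)) (h-basic s) ⟩
      h u ∙ (h b ∙ h v)  ≡⟨ cong (h u ∙_) (h-++ b v) ⟨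
      h u ∙ h (b ++ v)   ≡⟨ h-++ u (b ++ v) ⟨
      h (u ++ b ++ v)    ∎
      where open ≡-Reasoning

  record Character : Set where
    field
      χ    : Word → Parity
      χ-++ : ∀ x y → χ (x ++ y) ≡ χ x + χ y
      χ-≈  : ∀ {u v} → u ≈ v → χ u ≡ χ v
      χ-s₀ : χ (s₀ ∷ []) ≡ 1ℙ

  open Character

  parity-character : (f : Word → ℕ) → (∀ x y → f (x ++ y) ≡ f x ℕ.+ f y) →
                     (∀ {i j k} → M i j ≡ just k → parity k ≡ 0ℙ ⊎ parity (f (i ∷ j ∷ [])) ≡ 0ℙ) →
                     f (s₀ ∷ []) ≡ 1 → Character
  parity-character f f-++ braid-even f-s₀ = record
    { χ    = parity ∘ f
    ; χ-++ = parity-++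
    ; χ-≈  = ≈-invariant _+_ (parity ∘ f) parity-++ basic
    ; χ-s₀ = cong parity f-s₀
    }
    where
    parity-++ : ∀ x y → parity (f (x ++ y)) ≡ parity (f x) + parity (f y)
    parity-++ x y = trans (cong parity (f-++ x y)) (+-homo-+ (f x) (f y))

    parity-[] : parity (f []) ≡ 0ℙ
    parity-[] = cong parity (additive-[] f f-++)

    basic : ∀ {a b} → Basic a b → parity (f a) ≡ parity (f b)
    basic (inv i) =
      trans (parity-++ (i ∷ []) (i ∷ [])) (trans (p+p≡0ℙ (parity (f (i ∷ [])))) (sym parity-[]))
    basic (braid i j k Mij≡k) = begin
      parity (f (rep k (i ∷ j ∷ [])))      ≡⟨ cong parity (additive-rep f f-++ k (i ∷ j ∷ [])) ⟩
      parity (k ℕ.* f (i ∷ j ∷ []))        ≡⟨ *-homo-* k _ ⟩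
      parity k ℙ.* parity (f (i ∷ j ∷ [])) ≡⟨ p≡0ℙ⊎q≡0ℙ⇒p*q≡0ℙ (braid-even Mij≡k) ⟩
      0ℙ                                   ≡⟨ parity-[] ⟨
      parity (f [])                        ∎
      where open ≡-Reasoning

  ε : Character
  ε = parity-character length (λ x _ → length-++ x) (λ _ → inj₂ refl) refl

  count₀-++ : ∀ x y → count₀ (x ++ y) ≡ count₀ x ℕ.+ count₀ y
  count₀-++ []          y = refl
  count₀-++ (zero  ∷ x) y = cong suc (count₀-++ x y)
  count₀-++ (suc _ ∷ x) y = count₀-++ x y

  χ-[] : ∀ c → χ c [] ≡ 0ℙ
  χ-[] c = trans (χ-++ c [] []) (p+p≡0ℙ (χ c []))

  χ-concatMap : ∀ c {A : Set} {e : A → Word} → (∀ a → χ c (e a) ≡ 1ℙ) →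
                ∀ as → χ c (concatMap e as) ≡ parity (length as)
  χ-concatMap c e-odd []                 = χ-[] c
  χ-concatMap c {e = e} e-odd (a ∷ as) = begin
    χ c (e a ++ concatMap e as)       ≡⟨ χ-++ c (e a) _ ⟩
    χ c (e a) + χ c (concatMap e as)  ≡⟨ cong₂ _+_ (e-odd a) (χ-concatMap c e-odd as) ⟩
    1ℙ + parity (length as)           ≡⟨ +-homo-+ 1 (length as) ⟨
    parity (suc (length as))          ∎
    where open ≡-Reasoning

  χ-InGens : ∀ c {A : Set} {e : A → Word} {p} → (∀ a → χ c (e a) ≡ p) →
             ∀ {t} → InGens e t → χ c t ≡ p
  χ-InGens c e-p (a , ea≈t) = trans (sym (χ-≈ c ea≈t)) (e-p a)

  s₀^ : Parity → Word
  s₀^ 0ℙ = []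
  s₀^ 1ℙ = s₀ ∷ []

  χ-s₀^ : ∀ c p → χ c (s₀^ p) ≡ p
  χ-s₀^ c 0ℙ = χ-[] c
  χ-s₀^ c 1ℙ = χ-s₀ c

  s₀^-involutive : ∀ p x → ((x ++ s₀^ p) ++ s₀^ p) ≈ x
  s₀^-involutive 0ℙ x = ≡⇒≈ (trans (++-identityʳ _) (++-identityʳ x))
  s₀^-involutive 1ℙ x = begin
    (x ++ s₀ ∷ []) ++ s₀ ∷ []  ≡⟨ ++-assoc x _ _ ⟩
    x ++ s₀ ∷ s₀ ∷ []          ≈⟨ ≈-step x [] (inv s₀) ⟩
    x ++ []                    ≡⟨ ++-identityʳ x ⟩
    x                          ∎
    where open ≈-Reasoning

  pad : Character → Word → Word
  pad c u = u ++ s₀^ (χ c u)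

  pad-cong : ∀ c {u v} → u ≈ v → pad c u ≈ pad c v
  pad-cong c {u} {v} u≈v = begin
    u ++ s₀^ (χ c u)  ≈⟨ ++-congʳ _ u≈v ⟩
    v ++ s₀^ (χ c u)  ≡⟨ cong (λ p → v ++ s₀^ p) (χ-≈ c u≈v) ⟩
    v ++ s₀^ (χ c v)  ∎
    where open ≈-Reasoning

  χ-pad : ∀ c' c u → χ c' (pad c u) ≡ χ c' u + χ c u
  χ-pad c' c u = trans (χ-++ c' u _) (cong (χ c' u +_) (χ-s₀^ c' (χ c u)))

  χ-pad-self : ∀ c u → χ c (pad c u) ≡ 0ℙ
  χ-pad-self c u = trans (χ-pad c c u) (p+p≡0ℙ (χ c u))

  pad-inverse : ∀ c c' {u} → χ c' u ≡ 0ℙ → pad c' (pad c u) ≈ u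
  pad-inverse c c' {u} χ'u≡0 = begin
    pad c u ++ s₀^ (χ c' (pad c u))    ≡⟨ cong (λ p → pad c u ++ s₀^ p)
                                           (trans (χ-pad c' c u) (cong (_+ χ c u) χ'u≡0)) ⟩
    (u ++ s₀^ (χ c u)) ++ s₀^ (χ c u)  ≈⟨ s₀^-involutive (χ c u) u ⟩
    u                                  ∎
    where open ≈-Reasoning

  ψ : Word → Word
  ψ = pad ε

  φᵖ : Parity → Word → Word
  φᵖ 0ℙ t = t ++ s₀ ∷ []
  φᵖ 1ℙ t = s₀ ∷ t

  φᵖ-cong : ∀ p {t t'} → t ≈ t' → φᵖ p t ≈ φᵖ p t'
  φᵖ-cong 0ℙ = ++-congʳ (s₀ ∷ [])
  φᵖ-cong 1ℙ = ++-congˡ (s₀ ∷ [])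

  φᵖ-involutive : ∀ p t → φᵖ p (φᵖ p t) ≈ t
  φᵖ-involutive 0ℙ t = s₀^-involutive 1ℙ t
  φᵖ-involutive 1ℙ t = ≈-step [] t (inv s₀)

  φᵖ-++ : ∀ p x y → (φᵖ p x ++ s₀^ (p ⁻¹) ++ y) ≈ (s₀^ p ++ x ++ y)
  φᵖ-++ 0ℙ x y = ≈-trans (≡⇒≈ (++-assoc x (s₀ ∷ []) (s₀ ∷ y))) (≈-step x y (inv s₀))
  φᵖ-++ 1ℙ x y = ≈-refl

  φ≡φᵖ : ∀ k t → φ k t ≡ φᵖ (parity k) t
  φ≡φᵖ zero          t = refl
  φ≡φᵖ (suc zero)    t = refl
  φ≡φᵖ (suc (suc k)) t =
    trans (cong (λ b → if b then t ++ s₀ ∷ [] else s₀ ∷ t) (isEven-suc-suc k)) (φ≡φᵖ k t)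

  φ-cong : ∀ k {t t'} → t ≈ t' → φ k t ≈ φ k t'
  φ-cong k {t} {t'} t≈t' = begin
    φ k t               ≡⟨ φ≡φᵖ k t ⟩
    φᵖ (parity k) t     ≈⟨ φᵖ-cong (parity k) t≈t' ⟩
    φᵖ (parity k) t'    ≡⟨ φ≡φᵖ k t' ⟨
    φ k t'              ∎
    where open ≈-Reasoning

  φ-involutive : ∀ k t → φ k (φ k t) ≈ t
  φ-involutive k t = begin
    φ k (φ k t)                       ≡⟨ trans (φ≡φᵖ k _) (cong (φᵖ (parity k)) (φ≡φᵖ k t)) ⟩
    φᵖ (parity k) (φᵖ (parity k) t)   ≈⟨ φᵖ-involutive (parity k) t ⟩
    t                                 ∎
    where open ≈-Reasoning

  concat-alternate : {A B : Set} {eA : A → Word} {eB : B → Word} (f : Parity → A → B) →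
                     (∀ p a → eB (f p a) ≈ φᵖ p (eA a)) → ∀ p as →
                     concatMap eB (alternate f p as)
                       ≈ (s₀^ p ++ concatMap eA as ++ s₀^ (p + parity (length as)))
  concat-alternate f f-correct 0ℙ [] = ≈-refl
  concat-alternate f f-correct 1ℙ [] = ≈-sym (≈-step [] [] (inv s₀))
  concat-alternate {eA = eA} {eB} f f-correct p (a ∷ as) = begin
    eB (f p a) ++ concatMap eB (alternate f (p ⁻¹) as)
      ≈⟨ ++-cong (f-correct p a) (concat-alternate f f-correct (p ⁻¹) as) ⟩
    φᵖ p (eA a) ++ s₀^ (p ⁻¹) ++ concatMap eA as ++ s₀^ (p ⁻¹ + parity (length as))
      ≈⟨ φᵖ-++ p (eA a) _ ⟩
    s₀^ p ++ eA a ++ concatMap eA as ++ s₀^ (p ⁻¹ + parity (length as))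
      ≡⟨ cong (s₀^ p ++_) (++-assoc (eA a) _ _) ⟨
    s₀^ p ++ (eA a ++ concatMap eA as) ++ s₀^ (p ⁻¹ + parity (length as))
      ≡⟨ cong (λ q → s₀^ p ++ (eA a ++ concatMap eA as) ++ s₀^ q)
              (p⁻¹+parity≡p+parity-suc p (length as)) ⟩
    s₀^ p ++ (eA a ++ concatMap eA as) ++ s₀^ (p + parity (suc (length as)))
      ∎
    where open ≈-Reasoning

  alternate-pad : ∀ c {A B : Set} {eA : A → Word} {eB : B → Word} (f : Parity → A → B) →
                  (∀ p a → eB (f p a) ≈ φᵖ p (eA a)) → (∀ a → χ c (eA a) ≡ 1ℙ) →
                  ∀ as → concatMap eB (alternate f 0ℙ as) ≈ pad c (concatMap eA as)
  alternate-pad c {eA = eA} {eB} f f-correct eA-odd as = begin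
    concatMap eB (alternate f 0ℙ as)
      ≈⟨ concat-alternate f f-correct 0ℙ as ⟩
    concatMap eA as ++ s₀^ (parity (length as))
      ≡⟨ cong (λ p → concatMap eA as ++ s₀^ p) (χ-concatMap c eA-odd as) ⟨
    pad c (concatMap eA as)
      ∎
    where open ≈-Reasoning

  τ : Parity → S'Letter → RLetter
  τ 0ℙ (inj₁ i)  = inj₂ i
  τ 0ℙ (inj₂ tt) = inj₁ zero
  τ 1ℙ (inj₁ i)  = inj₁ i
  τ 1ℙ (inj₂ tt) = inj₂ zero

  τ-correct : ∀ p x → eR (τ p x) ≈ φᵖ p (eS' x)
  τ-correct 0ℙ (inj₁ i)  = ≈-refl
  τ-correct 0ℙ (inj₂ tt) = ≈-sym (≈-step (s₀ ∷ s₁ ∷ []) [] (inv s₀))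
  τ-correct 1ℙ (inj₁ i)  = ≈-refl
  τ-correct 1ℙ (inj₂ tt) = ≈-sym (≈-step [] (s₁ ∷ s₀ ∷ []) (inv s₀))

  InGens-τ : ∀ {p t} → InGens eS' t → InGens eR (φᵖ p t)
  InGens-τ {p} (x , ex≈t) = τ p x , ≈-trans (τ-correct p x) (φᵖ-cong p ex≈t)

  ε-eS' : ∀ x → χ ε (eS' x) ≡ 1ℙ
  ε-eS' (inj₁ i)  = refl
  ε-eS' (inj₂ tt) = refl

  ε-ℓS' : ∀ {u k} → ℓS'-is u k → χ ε u ≡ parity k
  ε-ℓS' ((xs , |xs|≡k , xs≈u) , _) =
    trans (sym (χ-≈ ε xs≈u)) (trans (χ-concatMap ε ε-eS' xs) (cong parity |xs|≡k))

  ψ-++ : ∀ {u t} → χ ε t ≡ 1ℙ → ψ (u ++ t) ≈ (ψ u ++ φᵖ (χ ε u) t)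
  ψ-++ {u} {t} εt≡1 = begin
    (u ++ t) ++ s₀^ (χ ε (u ++ t))      ≡⟨ cong (λ p → (u ++ t) ++ s₀^ p)
                                             (trans (χ-++ ε u t) (cong (χ ε u +_) εt≡1)) ⟩
    (u ++ t) ++ s₀^ (χ ε u + 1ℙ)        ≈⟨ ≈-sym (pad-φᵖ (χ ε u)) ⟩
    (u ++ s₀^ (χ ε u)) ++ φᵖ (χ ε u) t  ∎
    where
    open ≈-Reasoning
    pad-φᵖ : ∀ p → ((u ++ s₀^ p) ++ φᵖ p t) ≈ ((u ++ t) ++ s₀^ (p + 1ℙ))
    pad-φᵖ 0ℙ = ≡⇒≈ (trans (cong (_++ _) (++-identityʳ u)) (sym (++-assoc u t _)))
    pad-φᵖ 1ℙ = ≈-trans (≡⇒≈ (++-assoc u (s₀ ∷ []) _))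
                  (≈-trans (≈-step u t (inv s₀)) (≡⇒≈ (sym (++-identityʳ _))))

  module _ (cox : IsCoxeterMatrix M) (leaf : EvenLeaf M) where
    open IsCoxeterMatrix cox using (symm)
    open EvenLeaf leaf

    m₀₁-even : ∀ {k} → M s₀ s₁ ≡ just k → parity k ≡ 0ℙ
    m₀₁-even M≡k with m01
    ... | inj₁ M≡∞ with () ← trans (sym M≡∞) M≡k
    ... | inj₂ (k' , 2∣k' , M≡k') with refl ← just-injective (trans (sym M≡k') M≡k) =
      2∣⇒parity≡0ℙ 2∣k'

    m₀ⱼ≡2 : ∀ j {k} → M s₀ (suc (suc j)) ≡ just k → k ≡ 2
    m₀ⱼ≡2 j M≡k = sym (just-injective (trans (sym (m0j j)) M≡k))

    braid-count₀-even : ∀ {i j k} → M i j ≡ just k →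
                        parity k ≡ 0ℙ ⊎ parity (count₀ (i ∷ j ∷ [])) ≡ 0ℙ
    braid-count₀-even {zero}        {zero}        _   = inj₂ refl
    braid-count₀-even {zero}        {suc zero}    M≡k = inj₁ (m₀₁-even M≡k)
    braid-count₀-even {zero}        {suc (suc j)} M≡k = inj₁ (cong parity (m₀ⱼ≡2 j M≡k))
    braid-count₀-even {suc zero}    {zero}        M≡k = inj₁ (m₀₁-even (trans (symm _ _) M≡k))
    braid-count₀-even {suc (suc j)} {zero}        M≡k =
      inj₁ (cong parity (m₀ⱼ≡2 j (trans (symm _ _) M≡k)))
    braid-count₀-even {suc _}       {suc _}       _   = inj₂ refl

    χ₀ : Character
    χ₀ = parity-character count₀ count₀-++ braid-count₀-even refl

    γ : Word → Word
    γ = pad χ₀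

    ψ∈W⁺ : ∀ u → InW⁺ (ψ u)
    ψ∈W⁺ u = parity≡0ℙ⇒2∣ _ (χ-pad-self ε u)

    γ∈W' : ∀ w → InW' (γ w)
    γ∈W' w = parity≡0ℙ⇒2∣ _ (χ-pad-self χ₀ w)

    s₀sⱼs₀≈sⱼ : ∀ j → (s₀ ∷ suc (suc j) ∷ s₀ ∷ []) ≈ (suc (suc j) ∷ [])
    s₀sⱼs₀≈sⱼ j = ≈-trans (≈-sym (≈-step (s₀ ∷ suc (suc j) ∷ s₀ ∷ []) [] (inv (suc (suc j)))))
                          (≈-step [] (suc (suc j) ∷ []) (braid s₀ (suc (suc j)) 2 (m0j j)))

    σ : Parity → RLetter → S'Letter
    σ 0ℙ (inj₁ zero)    = inj₂ tt
    σ 0ℙ (inj₁ (suc j)) = inj₁ (suc j)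
    σ 0ℙ (inj₂ i)       = inj₁ i
    σ 1ℙ (inj₁ i)       = inj₁ i
    σ 1ℙ (inj₂ zero)    = inj₂ tt
    σ 1ℙ (inj₂ (suc j)) = inj₁ (suc j)

    σ-correct : ∀ p a → eS' (σ p a) ≈ φᵖ p (eR a)
    σ-correct 0ℙ (inj₁ zero)    = ≈-refl
    σ-correct 0ℙ (inj₁ (suc j)) = ≈-sym (s₀sⱼs₀≈sⱼ j)
    σ-correct 0ℙ (inj₂ i)       = ≈-sym (≈-step (suc i ∷ []) [] (inv s₀))
    σ-correct 1ℙ (inj₁ i)       = ≈-sym (≈-step [] (suc i ∷ []) (inv s₀))
    σ-correct 1ℙ (inj₂ zero)    = ≈-refl
    σ-correct 1ℙ (inj₂ (suc j)) = ≈-sym (s₀sⱼs₀≈sⱼ j)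

    InGens-σ : ∀ {p a} → InGens eR a → InGens eS' (φᵖ p a)
    InGens-σ {p} (y , ey≈a) = σ p y , ≈-trans (σ-correct p y) (φᵖ-cong p ey≈a)

    χ₀-eR : ∀ a → χ χ₀ (eR a) ≡ 1ℙ
    χ₀-eR (inj₁ i) = refl
    χ₀-eR (inj₂ i) = refl

    χ₀-eS' : ∀ x → χ χ₀ (eS' x) ≡ 0ℙ
    χ₀-eS' (inj₁ i)  = refl
    χ₀-eS' (inj₂ tt) = refl

    χ₀-++-InGens : ∀ {u t} → χ χ₀ u ≡ 0ℙ → InGens eS' t → χ χ₀ (u ++ t) ≡ 0ℙ
    χ₀-++-InGens {u} {t} χ₀u≡0 t∈S' =
      trans (χ-++ χ₀ u t) (cong₂ _+_ χ₀u≡0 (χ-InGens χ₀ χ₀-eS' t∈S'))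

    S'-word→R-word : ∀ {u} xs → concatMap eS' xs ≈ u → concatMap eR (alternate τ 0ℙ xs) ≈ ψ u
    S'-word→R-word xs xs≈u = ≈-trans (alternate-pad ε τ τ-correct ε-eS' xs) (pad-cong ε xs≈u)

    R-word→S'-word : ∀ {u} → χ χ₀ u ≡ 0ℙ →
                     ∀ ys → concatMap eR ys ≈ ψ u → concatMap eS' (alternate σ 0ℙ ys) ≈ u
    R-word→S'-word χ₀u≡0 ys ys≈ψu =
      ≈-trans (alternate-pad χ₀ σ σ-correct χ₀-eR ys)
        (≈-trans (pad-cong χ₀ ys≈ψu) (pad-inverse ε χ₀ χ₀u≡0))

    ℓS'⇒ℓR∘ψ : ∀ {u k} → χ χ₀ u ≡ 0ℙ → ℓS'-is u k → ℓR-is (ψ u) k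
    ℓS'⇒ℓR∘ψ χ₀u≡0 = IsLen-transfer (alternate τ 0ℙ) (alternate σ 0ℙ)
      (length-alternate τ 0ℙ) (length-alternate σ 0ℙ) S'-word→R-word (R-word→S'-word χ₀u≡0)

    ℓR∘ψ⇒ℓS' : ∀ {u k} → χ χ₀ u ≡ 0ℙ → ℓR-is (ψ u) k → ℓS'-is u k
    ℓR∘ψ⇒ℓS' χ₀u≡0 = IsLen-transfer (alternate σ 0ℙ) (alternate τ 0ℙ)
      (length-alternate σ 0ℙ) (length-alternate τ 0ℙ) (R-word→S'-word χ₀u≡0) S'-word→R-word

    ψ∘γ≈id : ∀ {w} → InW⁺ w → ψ (γ w) ≈ w
    ψ∘γ≈id w∈W⁺ = pad-inverse χ₀ ε (2∣⇒parity≡0ℙ w∈W⁺)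

    ℓR⇒ℓS'∘γ : ∀ {w k} → InW⁺ w → ℓR-is w k → ℓS'-is (γ w) k
    ℓR⇒ℓS'∘γ {w} w∈W⁺ L = ℓR∘ψ⇒ℓS' (χ-pad-self χ₀ w) (IsLen-resp (≈-sym (ψ∘γ≈id w∈W⁺)) L)

    DesS'⇒DesR : ∀ {u w t} → χ χ₀ u ≡ 0ℙ → ψ u ≈ w → DesS' u t → DesR w (φᵖ (χ ε u) t)
    DesS'⇒DesR {u} χ₀u≡0 ψu≈w = InDes-transfer (InGens-τ {χ ε u})
      (λ L → IsLen-resp ψu≈w (ℓS'⇒ℓR∘ψ χ₀u≡0 L))
      (λ t∈S' L → IsLen-resp (≈-trans (ψ-++ {u} (χ-InGens ε ε-eS' t∈S')) (++-congʳ _ ψu≈w))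
                             (ℓS'⇒ℓR∘ψ (χ₀-++-InGens {u} χ₀u≡0 t∈S') L))

    DesR⇒DesS' : ∀ {u w a} → χ χ₀ u ≡ 0ℙ → ψ u ≈ w → DesR w a → DesS' u (φᵖ (χ ε u) a)
    DesR⇒DesS' {u} {a = a} χ₀u≡0 ψu≈w = InDes-transfer t∈S'
      (λ L → ℓR∘ψ⇒ℓS' χ₀u≡0 (IsLen-resp (≈-sym ψu≈w) L))
      (λ a∈R L → ℓR∘ψ⇒ℓS' (χ₀-++-InGens {u} χ₀u≡0 (t∈S' a∈R))
        (IsLen-resp (≈-trans (++-cong (≈-sym ψu≈w) (≈-sym (φᵖ-involutive p a)))
                             (≈-sym (ψ-++ {u} (χ-InGens ε ε-eS' (t∈S' a∈R))))) L))
      where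
      p : Parity
      p = χ ε u
      t∈S' : InGens eR a → InGens eS' (φᵖ p a)
      t∈S' = InGens-σ {p}

    DesS'≅DesR : ∀ {u w k} → InW' u → ℓS'-is u k → ψ u ≈ w → DesS' u ≅ DesR w
    DesS'≅DesR {u} {w} {k} u∈W' L ψu≈w = record
      { to        = φ k
      ; from      = φ k
      ; to-cong   = φ-cong k
      ; from-cong = φ-cong k
      ; to-pres   = λ {t} d → subst (DesR w) (sym (φ≡φᵖ-ε t)) (DesS'⇒DesR χ₀u≡0 ψu≈w d)
      ; from-pres = λ {a} d → subst (DesS' u) (sym (φ≡φᵖ-ε a)) (DesR⇒DesS' χ₀u≡0 ψu≈w d)
      ; from∘to   = λ _ → φ-involutive k _
      ; to∘from   = λ _ → φ-involutive k _
      }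
      where
      χ₀u≡0 : χ χ₀ u ≡ 0ℙ
      χ₀u≡0 = 2∣⇒parity≡0ℙ u∈W'
      φ≡φᵖ-ε : ∀ t → φ k t ≡ φᵖ (χ ε u) t
      φ≡φᵖ-ε t = trans (φ≡φᵖ k t) (cong (λ p → φᵖ p t) (sym (ε-ℓS' L)))

    DesS'∘γ≅DesR : ∀ {w k} → InW⁺ w → ℓR-is w k → DesS' (γ w) ≅ DesR w
    DesS'∘γ≅DesR {w} w∈W⁺ L = DesS'≅DesR (γ∈W' w) (ℓR⇒ℓS'∘γ w∈W⁺ L) (ψ∘γ≈id w∈W⁺)

    W⁺≅W' : {X Y : Word → Set} →
            (∀ {w} → InW⁺ w → X w → Y (γ w)) → (∀ {u} → InW' u → Y u → X (ψ u)) →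
            (λ w → InW⁺ w × X w) ≅ (λ u → InW' u × Y u)
    W⁺≅W' X⇒Y∘γ Y⇒X∘ψ = record
      { to        = γ
      ; from      = ψ
      ; to-cong   = pad-cong χ₀
      ; from-cong = pad-cong ε
      ; to-pres   = λ {w} (w∈W⁺ , Xw) → γ∈W' w , X⇒Y∘γ w∈W⁺ Xw
      ; from-pres = λ {u} (u∈W' , Yu) → ψ∈W⁺ u , Y⇒X∘ψ u∈W' Yu
      ; from∘to   = λ (w∈W⁺ , _) → ψ∘γ≈id w∈W⁺
      ; to∘from   = λ (u∈W' , _) → pad-inverse ε χ₀ (2∣⇒parity≡0ℙ u∈W')
      }

    W⁺≅W'-ℓ : ∀ k → (λ w → InW⁺ w × ℓR-is w k) ≅ (λ u → InW' u × ℓS'-is u k)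
    W⁺≅W'-ℓ k = W⁺≅W' ℓR⇒ℓS'∘γ (ℓS'⇒ℓR∘ψ ∘ 2∣⇒parity≡0ℙ)

    W⁺≅W'-ℓ-des : ∀ k d → (λ w → InW⁺ w × ℓR-is w k × HasCard (DesR w) d)
                         ≅ (λ u → InW' u × ℓS'-is u k × HasCard (DesS' u) d)
    W⁺≅W'-ℓ-des k d = W⁺≅W'
      (λ w∈W⁺ (L , des) → ℓR⇒ℓS'∘γ w∈W⁺ L ,
         HasCard-≅ (≅-sym (DesS'∘γ≅DesR w∈W⁺ L)) des)
      (λ u∈W' (L , des) → ℓS'⇒ℓR∘ψ (2∣⇒parity≡0ℙ u∈W') L ,
         HasCard-≅ (DesS'≅DesR u∈W' L ≈-refl) des)

    W⁺≅W'-ℓ-Des : ∀ k (D : Word → Set) →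
                  (λ w → InW⁺ w × ℓR-is w k × (∀ a → DesR w a ⇔ D a))
                  ≅ (λ u → InW' u × ℓS'-is u k
                           × (∀ a → D a ⇔ Σ Word (λ t → DesS' u t × φ k t ≈ a)))
    W⁺≅W'-ℓ-Des k D = W⁺≅W'
      (λ w∈W⁺ (L , DesR⇔D) → ℓR⇒ℓS'∘γ w∈W⁺ L ,
         λ a → ≅-image (DesS'∘γ≅DesR w∈W⁺ L) InDes-respʳ ⇔-∘ ⇔-sym (DesR⇔D a))
      (λ u∈W' (L , D⇔DesS') → ℓS'⇒ℓR∘ψ (2∣⇒parity≡0ℙ u∈W') L ,
         λ a → ⇔-sym (D⇔DesS' a) ⇔-∘ ≅-image (DesS'≅DesR u∈W' L ≈-refl) InDes-respʳ)

corollary5p6 :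
    (m : ℕ) (M : Gen m → Gen m → Maybe ℕ) → IsCoxeterMatrix M → EvenLeaf M →
    let open Cox M in
    -- main identity: coefficient of q^k times the squarefree monomial ∏_{a∈D} x_a
    ((k : ℕ) (D : Word → Set) (c : ℕ) →
      HasCard (λ w → InW⁺ w × ℓR-is w k × (∀ a → DesR w a ⇔ D a)) c
      ⇔ HasCard (λ u → InW' u × ℓS'-is u k
                   × (∀ a → D a ⇔ Σ Word (λ t → DesS' u t × φ k t ≈ a))) c)
    -- coefficient of t^d q^k
    × ((k d c : ℕ) →
      HasCard (λ w → InW⁺ w × ℓR-is w k × HasCard (DesR w) d) c
      ⇔ HasCard (λ u → InW' u × ℓS'-is u k × HasCard (DesS' u) d) c)
    -- coefficient of q^k
    × ((k c : ℕ) →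
      HasCard (λ w → InW⁺ w × ℓR-is w k) c
      ⇔ HasCard (λ u → InW' u × ℓS'-is u k) c)
corollary5p6 m M cox leaf =
    (λ k D c → HasCard-cong (W⁺≅W'-ℓ-Des cox leaf k D))
  , (λ k d c → HasCard-cong (W⁺≅W'-ℓ-des cox leaf k d))
  , (λ k c → HasCard-cong (W⁺≅W'-ℓ cox leaf k))
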